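{- Let $r\ge 2$, $n\ge d\ge 1$, and suppose rounds $1,\dots,r-1$ have been played (with any strategies) and the answers received are consistent with at least one set of excellent elements. Let $A$ be a smallest subset of $[n]$ that intersects every member of $\mathcal G_{r-1}$. Let $\mathcal F_r$ be a family of queries posed in round $r$ that suffices for the Questioner to reach the goal (name $d$ distinct excellent elements, or correctly state that there are at most $d-1$ excellent elements). Then - if $|A|\ge d$, then $|\mathcal F_r|\ge m_{r-1}(d)-d$; - if $|A|<d$, then $|\mathcal F_r|\ge n-|G_{r-1}|-d+1$.
   Context: Setting: an unknown set $E\subseteq[n]$ of excellent elements; in round $t$ the Questioner poses a finite family $\mathcal F_t$ of subsets of $[n]$ (depending on earlier answers); the answer to a query $Q$ is "yes" iff $Q\cap E\neq\emptyset$. Notation: $\mathcal F_t^Y,\mathcal F_t^N$ are the queries of round $t$ answered yes/no; $G_t=\bigcup\{F:F\in\mathcal F_j^N,\ j\le t\}$; $\mathcal G_t=\{F\setminus G_t:F\in\mathcal F_j^Y,\ j\le t\}$. For a family $\mathcal F$ and $1\le i\le d$, $m(i,\mathcal F)=\min\{|A_1\cup\dots\cup A_i|: A_1,\dots,A_i \text{ pairwise distinct members of }\mathcal F\}$, and $m_t(i)=m(i,\mathcal G_t)$. A set $E'\subseteq[n]$ is consistent with the answers of rounds $1,\dots,r-1$ iff $E'\cap G_{r-1}=\emptyset$ and $E'$ meets every member of $\mathcal G_{r-1}$. The family $\mathcal F_r$ suffices if for every consistent $E$, letting $\mathcal C$ be the collection of all sets consistent with the answers of rounds $1,\dots,r-1$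 that give the same answers on $\mathcal F_r$ as $E$, either every member of $\mathcal C$ has at most $d-1$ elements, or there are $d$ distinct elements lying in every member of $\mathcal C$. Standing convention: every member of $\mathcal F_t$ is a subset of $[n]\setminus G_{t-1}$. -}

module Defs where

open import Data.Nat using (ℕ; _≤_; _∸_)
open import Data.Bool using (Bool; true; false)
open import Data.Fin using (Fin)
open import Data.Fin.Subset using (Subset; _∩_; _∪_; _─_; ∁; ⋃; ∣_∣; Nonempty; Empty; _⊆_; _∈_; ⊥)
open import Data.List using (List; []; _∷_; map; filter; length)
open import Data.List.Relation.Unary.All using (All)
open import Data.List.Membership.Propositional using () renaming (_∈_ to _∈ₗ_)
open import Data.Product using (Σ; _×_; _,_; proj₁; proj₂; ∃)
open import Data.Sum using (_⊎_)
open import Data.Unit using (⊤)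
open import Relation.Binary.PropositionalEquality using (_≡_)
open import Relation.Nullary using (¬_)
open import Function using (_⇔_)
open import Function.Definitions using (Injective)
open import Data.Vec.Functional using (toList)

-- A query Q is answered "yes" w.r.t. a set E iff Q ∩ E ≠ ∅.
Meets : ∀ {n} → Subset n → Subset n → Set
Meets Q E = Nonempty (Q ∩ E)

-- One played round: the queries of the round together with the answer received
-- (true = yes, false = no).
Round : ℕ → Set
Round n = List (Subset n × Bool)

noUnion : ∀ {n} → Round n → Subset n
noUnion [] = ⊥
noUnion ((Q , true) ∷ R) = noUnion R
noUnion ((Q , false) ∷ R) = Q ∪ noUnion R

yesQueries : ∀ {n} → Round n → List (Subset n)
yesQueries [] = []
yesQueries ((Q , true) ∷ R) = Q ∷ yesQueries R
yesQueries ((Q , false) ∷ R) = yesQueries R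

-- A history = the rounds 1,…,t in chronological order.
-- G_t = union of all queries answered "no" in rounds ≤ t.
Gset : ∀ {n} → List (Round n) → Subset n
Gset [] = ⊥
Gset (R ∷ Rs) = noUnion R ∪ Gset Rs

allYes : ∀ {n} → List (Round n) → List (Subset n)
allYes [] = []
allYes (R ∷ Rs) = yesQueries R Data.List.++ allYes Rs

-- 𝒢_t = { F ∖ G_t : F answered yes in some round ≤ t } (as a list; duplicates
-- are harmless since all notions below only use membership / distinctness).
calG : ∀ {n} → List (Round n) → List (Subset n)
calG H = map (λ F → F ─ Gset H) (allYes H)

-- Standing convention: each query of round t is a subset of [n] ∖ G_{t-1}.
-- The first argument is G of the rounds already played.
ConventionFrom : ∀ {n} → Subset n → List (Round n) → Set
ConventionFrom g [] = ⊤
ConventionFrom g (R ∷ Rs) =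
  All (λ qa → proj₁ qa ⊆ ∁ g) R × ConventionFrom (g ∪ noUnion R) Rs

Convention : ∀ {n} → List (Round n) → Set
Convention H = ConventionFrom ⊥ H

AnswersAgree : ∀ {n} → Subset n → List (Round n) → Set
AnswersAgree E H = All (All (λ qa → (proj₂ qa ≡ true) ⇔ Meets (proj₁ qa) E)) H

AnswersConsistent : ∀ {n} → List (Round n) → Set
AnswersConsistent {n} H = Σ (Subset n) λ E → AnswersAgree E H

ConsistentWith : ∀ {n} → List (Round n) → Subset n → Set
ConsistentWith H E' = Empty (E' ∩ Gset H) × All (λ F → Meets F E') (calG H)

Hits : ∀ {n} → Subset n → List (Subset n) → Set
Hits A 𝒢 = All (λ F → Meets F A) 𝒢

SmallestHitting : ∀ {n} → Subset n → List (Subset n) → Set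
SmallestHitting {n} A 𝒢 = Hits A 𝒢 × (∀ (B : Subset n) → Hits B 𝒢 → ∣ A ∣ ≤ ∣ B ∣)

DistinctMembers : ∀ {n} → (i : ℕ) → List (Subset n) → (Fin i → Subset n) → Set
DistinctMembers i 𝒢 As = Injective _≡_ _≡_ As × (∀ k → As k ∈ₗ 𝒢)

-- IsM i 𝒢 m : m = m(i, 𝒢) = min { |A₁ ∪ … ∪ Aᵢ| : A's pairwise distinct members of 𝒢 }.
IsM : ∀ {n} → ℕ → List (Subset n) → ℕ → Set
IsM {n} i 𝒢 m =
  (Σ (Fin i → Subset n) λ As → DistinctMembers i 𝒢 As × ∣ ⋃ (toList As) ∣ ≡ m)
  × (∀ (As : Fin i → Subset n) → DistinctMembers i 𝒢 As → m ≤ ∣ ⋃ (toList As) ∣)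

SameAnswers : ∀ {n} → List (Subset n) → Subset n → Subset n → Set
SameAnswers F E E' = All (λ Q → Meets Q E ⇔ Meets Q E') F

Suffices : ∀ {n} → ℕ → List (Round n) → List (Subset n) → Set
Suffices {n} d H F =
  ∀ (E : Subset n) → ConsistentWith H E →
    (∀ (E' : Subset n) → ConsistentWith H E' → SameAnswers F E E' → ∣ E' ∣ ≤ d ∸ 1)
    ⊎ (Σ (Fin d → Fin n) λ xs → Injective _≡_ _≡_ xs ×
        (∀ (E' : Subset n) → ConsistentWith H E' → SameAnswers F E E' →
           ∀ k → xs k ∈ E'))

-- For a set S consistent with the history, count the queries of the round
-- that S answers "yes".  If |S| ≥ d, sufficiency pins d elements of S, and
-- deleting a pinned element x while staying consistent must change some
-- answer; deletions only turn "yes" into "no", so the count drops.  Hence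
-- walking down from W = [n] ∖ G_{r-1} by deleting pinned elements costs one
-- query per deleted element.  If a transversal B with |B| < d exists, we can
-- always delete a pinned element outside B until fewer than d elements are
-- left, giving |W| - d + 1 ≤ |F_r|.  Otherwise we delete while possible; at
-- a set S where no pinned x_k can be deleted, each x_k is the only point of S
-- on some G_k ∈ 𝒢, the G_k are distinct and ⋃ G_k ⊆ (W ∖ S) ∪ {x_1,…,x_d},
-- so m(d) ≤ |W ∖ S| + d ≤ |F_r| + d.
module Submission where

open import Defs
open import Data.Nat using (ℕ; _≤_; _+_; _∸_; _<_)
open import Data.Fin.Subset using (Subset; ∣_∣; _⊆_; ∁)
open import Data.List using (List; length)
open import Data.List.Relation.Unary.All using (All)
open import Data.List.Relation.Unary.Unique.Propositional using (Unique)
open import Relation.Binary.PropositionalEquality using (_≡_)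
open import Data.Product using (_×_)

open import Data.Nat using (zero; suc; z≤n; s≤s; z<s; _<?_)
open import Data.Nat.Properties hiding (_≟_; suc-injective)
open import Data.Fin using (Fin; zero; suc; _≟_)
open import Data.Fin.Properties using (any?; ¬∀⟶∃¬; suc-injective)
open import Data.Fin.Subset
open import Data.Fin.Subset.Properties
open import Data.Fin.Subset.Induction using (⊂-wellFounded; Acc; acc)
open import Data.List using ([]; _∷_)
open import Data.List.Relation.Unary.All using ([]; _∷_; all?; lookup; universal) renaming (map to All-map)
open import Data.List.Relation.Unary.All.Properties using (¬All⇒Any¬) renaming (map⁺ to All-map⁺)
open import Data.List.Membership.Propositional using (find) renaming (_∈_ to _∈ₗ_)
open import Data.Vec using (_∷_; []; here; there)
open import Data.Vec.Functional using (toList)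
open import Data.Product using (∃; _,_; proj₁; proj₂)
open import Data.Sum using (_⊎_; inj₁; inj₂) renaming (map to ⊎-map; map₁ to ⊎-map₁)
open import Relation.Nullary using (¬_; yes; no; Dec; contradiction)
open import Relation.Binary.PropositionalEquality using (refl; sym; trans; cong; subst)
open import Function using (mk⇔; id; _∘_; flip)
open import Function.Definitions using (Injective)
open import Data.Nat.Solver using (module +-*-Solver)

private
  variable
    n d : ℕ

x∈p─q⁻ : ∀ {x : Fin n} (p q : Subset n) → x ∈ p ─ q → x ∈ p × x ∉ q
x∈p─q⁻ (s ∷ p) (t ∷ q) (there x∈) with x∈p─q⁻ p q x∈
... | x∈p , x∉q = there x∈p , λ { (there x∈q) → x∉q x∈q }
x∈p─q⁻ (inside ∷ p) (outside ∷ q) here = here , λ ()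

p─q⊆∁q : (p q : Subset n) → p ─ q ⊆ ∁ q
p─q⊆∁q p q x∈ = x∉p⇒x∈∁p (proj₂ (x∈p─q⁻ p q x∈))

∣p∪q∣≤∣p∣+∣q∣ : (p q : Subset n) → ∣ p ∪ q ∣ ≤ ∣ p ∣ + ∣ q ∣
∣p∪q∣≤∣p∣+∣q∣ [] [] = z≤n
∣p∪q∣≤∣p∣+∣q∣ (inside ∷ p) (outside ∷ q) = s≤s (∣p∪q∣≤∣p∣+∣q∣ p q)
∣p∪q∣≤∣p∣+∣q∣ (inside ∷ p) (inside ∷ q) =
  s≤s (≤-trans (∣p∪q∣≤∣p∣+∣q∣ p q) (+-monoʳ-≤ ∣ p ∣ (n≤1+n ∣ q ∣)))
∣p∪q∣≤∣p∣+∣q∣ (outside ∷ p) (inside ∷ q) =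
  subst (suc ∣ p ∪ q ∣ ≤_) (sym (+-suc ∣ p ∣ ∣ q ∣)) (s≤s (∣p∪q∣≤∣p∣+∣q∣ p q))
∣p∪q∣≤∣p∣+∣q∣ (outside ∷ p) (outside ∷ q) = ∣p∪q∣≤∣p∣+∣q∣ p q

∣p∣≡∣p─q∣+∣p∩q∣ : (p q : Subset n) → ∣ p ∣ ≡ ∣ p ─ q ∣ + ∣ p ∩ q ∣
∣p∣≡∣p─q∣+∣p∩q∣ [] [] = refl
∣p∣≡∣p─q∣+∣p∩q∣ (inside ∷ p) (inside ∷ q) =
  trans (cong suc (∣p∣≡∣p─q∣+∣p∩q∣ p q)) (sym (+-suc ∣ p ─ q ∣ ∣ p ∩ q ∣))
∣p∣≡∣p─q∣+∣p∩q∣ (inside ∷ p) (outside ∷ q) = cong suc (∣p∣≡∣p─q∣+∣p∩q∣ p q)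
∣p∣≡∣p─q∣+∣p∩q∣ (outside ∷ p) (inside ∷ q) = ∣p∣≡∣p─q∣+∣p∩q∣ p q
∣p∣≡∣p─q∣+∣p∩q∣ (outside ∷ p) (outside ∷ q) = ∣p∣≡∣p─q∣+∣p∩q∣ p q

q⊆p⇒∣p─q∣+∣q∣≤∣p∣ : (p q : Subset n) → q ⊆ p → ∣ p ─ q ∣ + ∣ q ∣ ≤ ∣ p ∣
q⊆p⇒∣p─q∣+∣q∣≤∣p∣ p q q⊆p = subst (∣ p ─ q ∣ + ∣ q ∣ ≤_) (sym (∣p∣≡∣p─q∣+∣p∩q∣ p q))
  (+-monoʳ-≤ ∣ p ─ q ∣ (p⊆q⇒∣p∣≤∣q∣ (λ x∈q → x∈p∩q⁺ (q⊆p x∈q , x∈q))))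

∣p∣≤1+∣p-x∣ : (p : Subset n) (x : Fin n) → ∣ p ∣ ≤ suc ∣ p - x ∣
∣p∣≤1+∣p-x∣ p x = begin
  ∣ p ∣                       ≡⟨ ∣p∣≡∣p─q∣+∣p∩q∣ p ⁅ x ⁆ ⟩
  ∣ p - x ∣ + ∣ p ∩ ⁅ x ⁆ ∣   ≤⟨ +-monoʳ-≤ ∣ p - x ∣ (∣p∩q∣≤∣q∣ p ⁅ x ⁆) ⟩
  ∣ p - x ∣ + ∣ ⁅ x ⁆ ∣       ≡⟨ cong (∣ p - x ∣ +_) (∣⁅x⁆∣≡1 x) ⟩
  ∣ p - x ∣ + 1               ≡⟨ +-comm ∣ p - x ∣ 1 ⟩
  suc ∣ p - x ∣               ∎
  where open ≤-Reasoning

∣∁p∣+∣p∣≡n : (p : Subset n) → ∣ ∁ p ∣ + ∣ p ∣ ≡ n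
∣∁p∣+∣p∣≡n p = trans (cong (_+ ∣ p ∣) (∣∁p∣≡n∸∣p∣ p)) (m∸n+n≡m (∣p∣≤n p))

injection⇒d≤∣p∣ : (xs : Fin d → Fin n) → Injective _≡_ _≡_ xs →
  (p : Subset n) → (∀ k → xs k ∈ p) → d ≤ ∣ p ∣
injection⇒d≤∣p∣ {zero} xs _ p _ = z≤n
injection⇒d≤∣p∣ {suc d} xs xs-inj p xs∈p =
  ≤-trans (s≤s (injection⇒d≤∣p∣ (xs ∘ suc) (suc-injective ∘ xs-inj) (p - xs zero)
                  (λ k → x∈p∧x≢y⇒x∈p-y (xs∈p (suc k)) (zero≢suc ∘ xs-inj ∘ sym))))
          (x∈p⇒∣p-x∣<∣p∣ (xs∈p zero))
  where
  zero≢suc : ∀ {k : Fin d} → ¬ zero ≡ suc k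
  zero≢suc ()

x∈⋃tabulate⁻ : (ps : Fin d → Subset n) {x : Fin n} → x ∈ ⋃ (toList ps) → ∃ λ k → x ∈ ps k
x∈⋃tabulate⁻ {zero} ps x∈ = contradiction x∈ ∉⊥
x∈⋃tabulate⁻ {suc d} ps x∈ with x∈p∪q⁻ (ps zero) (⋃ (toList (ps ∘ suc))) x∈
... | inj₁ x∈p₀ = zero , x∈p₀
... | inj₂ x∈⋃ with x∈⋃tabulate⁻ (ps ∘ suc) x∈⋃
...   | k , x∈pₖ = suc k , x∈pₖ

x∈⋃tabulate⁺ : (ps : Fin d → Subset n) (k : Fin d) {x : Fin n} → x ∈ ps k → x ∈ ⋃ (toList ps)
x∈⋃tabulate⁺ {suc d} ps zero x∈ = x∈p∪q⁺ (inj₁ x∈)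
x∈⋃tabulate⁺ {suc d} ps (suc k) x∈ = x∈p∪q⁺ {p = ps zero} (inj₂ (x∈⋃tabulate⁺ (ps ∘ suc) k x∈))

∣⋃⁅xs⁆∣≤d : (xs : Fin d → Fin n) → ∣ ⋃ (toList (⁅_⁆ ∘ xs)) ∣ ≤ d
∣⋃⁅xs⁆∣≤d {zero} {n} xs = ≤-reflexive (∣⊥∣≡0 n)
∣⋃⁅xs⁆∣≤d {suc d} xs = ≤-trans (∣p∪q∣≤∣p∣+∣q∣ ⁅ xs zero ⁆ rest)
  (subst (λ c → c + ∣ rest ∣ ≤ suc d) (sym (∣⁅x⁆∣≡1 (xs zero))) (s≤s (∣⋃⁅xs⁆∣≤d (xs ∘ suc))))
  where rest = ⋃ (toList (⁅_⁆ ∘ xs ∘ suc))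

-- ⋃ ps ⊆ (q ─ p) ∪ {xs 0, …, xs (d-1)}.
∣⋃ps∣+∣p∣≤d+∣q∣ : (ps : Fin d → Subset n) (xs : Fin d → Fin n) {p q : Subset n} →
  p ⊆ q → (∀ k → ps k ⊆ q) → (∀ k {y} → y ∈ ps k → y ∈ p → y ≡ xs k) →
  ∣ ⋃ (toList ps) ∣ + ∣ p ∣ ≤ d + ∣ q ∣
∣⋃ps∣+∣p∣≤d+∣q∣ {d} ps xs {p} {q} p⊆q ps⊆q trace = begin
  ∣ ⋃ (toList ps) ∣ + ∣ p ∣   ≤⟨ +-monoˡ-≤ ∣ p ∣ (p⊆q⇒∣p∣≤∣q∣ ⋃ps⊆) ⟩
  ∣ (q ─ p) ∪ X ∣ + ∣ p ∣     ≤⟨ +-monoˡ-≤ ∣ p ∣ (∣p∪q∣≤∣p∣+∣q∣ (q ─ p) X) ⟩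
  ∣ q ─ p ∣ + ∣ X ∣ + ∣ p ∣   ≤⟨ +-monoˡ-≤ ∣ p ∣ (+-monoʳ-≤ ∣ q ─ p ∣ (∣⋃⁅xs⁆∣≤d xs)) ⟩
  ∣ q ─ p ∣ + d + ∣ p ∣       ≡⟨ trans (cong (_+ ∣ p ∣) (+-comm ∣ q ─ p ∣ d)) (+-assoc d ∣ q ─ p ∣ ∣ p ∣) ⟩
  d + (∣ q ─ p ∣ + ∣ p ∣)     ≤⟨ +-monoʳ-≤ d (q⊆p⇒∣p─q∣+∣q∣≤∣p∣ q p p⊆q) ⟩
  d + ∣ q ∣                   ∎
  where
  open ≤-Reasoning
  X = ⋃ (toList (⁅_⁆ ∘ xs))
  ⋃ps⊆ : ⋃ (toList ps) ⊆ (q ─ p) ∪ X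
  ⋃ps⊆ {y} y∈ with x∈⋃tabulate⁻ ps y∈
  ... | k , y∈psₖ with y ∈? p
  ...   | yes y∈p = x∈p∪q⁺ {p = q ─ p} (inj₂ (x∈⋃tabulate⁺ (⁅_⁆ ∘ xs) k
                      (subst (_∈ ⁅ xs k ⁆) (sym (trace k y∈psₖ y∈p)) (x∈⁅x⁆ (xs k)))))
  ...   | no y∉p = x∈p∪q⁺ (inj₁ (x∈p∧x∉q⇒x∈p─q (ps⊆q k y∈psₖ) y∉p))

-- A potential w that drops on every deletion step pays for the deleted elements.
Deletable : (w : Subset n → ℕ) (P : Subset n → Set) → Subset n → Set
Deletable w P S = ∃ λ x → x ∈ S × P (S - x) × w (S - x) < w S

descent-bound : (w : Subset n → ℕ) (P : Subset n → Set) {b c : ℕ} →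
  (∀ {S} → P S → Deletable w P S ⊎ b + ∣ S ∣ ≤ w S + c) →
  ∀ {S} → P S → b + ∣ S ∣ ≤ w S + c
descent-bound w P {b} {c} step {S} = go (⊂-wellFounded S)
  where
  open ≤-Reasoning
  go : ∀ {S} → Acc _⊂_ S → P S → b + ∣ S ∣ ≤ w S + c
  go {S} (acc rec) PS with step PS
  ... | inj₂ bound = bound
  ... | inj₁ (x , x∈S , PS-x , drop) = begin
    b + ∣ S ∣             ≤⟨ +-monoʳ-≤ b (∣p∣≤1+∣p-x∣ S x) ⟩
    b + suc ∣ S - x ∣     ≡⟨ +-suc b ∣ S - x ∣ ⟩
    suc (b + ∣ S - x ∣)   ≤⟨ s≤s (go (rec (x∈p⇒p-x⊂p x∈S)) PS-x) ⟩
    suc (w (S - x) + c)   ≤⟨ +-monoˡ-≤ c drop ⟩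
    w S + c               ∎

meets-⊆ : {p q : Subset n} (Q : Subset n) → p ⊆ q → Meets Q p → Meets Q q
meets-⊆ {p = p} Q p⊆q (x , x∈) with x∈p∩q⁻ Q p x∈
... | x∈Q , x∈p = x , x∈p∩q⁺ (x∈Q , p⊆q x∈p)

hits-⊆ : {p q : Subset n} {𝒢 : List (Subset n)} → p ⊆ q → Hits p 𝒢 → Hits q 𝒢
hits-⊆ p⊆q = All-map (meets-⊆ _ p⊆q)

hits? : (S : Subset n) (𝒢 : List (Subset n)) → Dec (Hits S 𝒢)
hits? S = all? (λ Q → nonempty? (Q ∩ S))

¬hits⇒unmet : {S : Subset n} (𝒢 : List (Subset n)) → ¬ Hits S 𝒢 →
  ∃ λ Q → Q ∈ₗ 𝒢 × ¬ Meets Q S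
¬hits⇒unmet {S = S} 𝒢 ¬hits = find (¬All⇒Any¬ (λ Q → nonempty? (Q ∩ S)) 𝒢 ¬hits)

hits-─ : {A g : Subset n} {𝒢 : List (Subset n)} → All (_⊆ ∁ g) 𝒢 → Hits A 𝒢 → Hits (A ─ g) 𝒢
hits-─ [] [] = []
hits-─ {A = A} (Q⊆∁g ∷ ⊆∁g) ((x , x∈) ∷ hits) with x∈p∩q⁻ _ A x∈
... | x∈Q , x∈A =
  (x , x∈p∩q⁺ (x∈Q , x∈p∧x∉q⇒x∈p─q x∈A (x∈∁p⇒x∉p (Q⊆∁g x∈Q)))) ∷ hits-─ ⊆∁g hits

¬meets-p-x⇒≡ : {Q p : Subset n} {x y : Fin n} → ¬ Meets Q (p - x) → y ∈ Q → y ∈ p → y ≡ x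
¬meets-p-x⇒≡ {x = x} {y} ¬meets y∈Q y∈p with y ≟ x
... | yes y≡x = y≡x
... | no y≢x = contradiction (y , x∈p∩q⁺ (y∈Q , x∈p∧x≢y⇒x∈p-y y∈p y≢x)) ¬meets

yesCount : List (Subset n) → Subset n → ℕ
yesCount [] S = 0
yesCount (Q ∷ F) S with nonempty? (Q ∩ S)
... | yes _ = suc (yesCount F S)
... | no _ = yesCount F S

yesCount≤length : (F : List (Subset n)) (S : Subset n) → yesCount F S ≤ length F
yesCount≤length [] S = z≤n
yesCount≤length (Q ∷ F) S with nonempty? (Q ∩ S)
... | yes _ = s≤s (yesCount≤length F S)
... | no _ = m≤n⇒m≤1+n (yesCount≤length F S)

yesCount-mono : (F : List (Subset n)) {S' S : Subset n} → S' ⊆ S → yesCount F S' ≤ yesCount F S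
yesCount-mono [] S'⊆S = z≤n
yesCount-mono (Q ∷ F) {S'} {S} S'⊆S with nonempty? (Q ∩ S') | nonempty? (Q ∩ S)
... | yes _ | yes _ = s≤s (yesCount-mono F S'⊆S)
... | yes meets | no ¬meets = contradiction (meets-⊆ Q S'⊆S meets) ¬meets
... | no _ | yes _ = m≤n⇒m≤1+n (yesCount-mono F S'⊆S)
... | no _ | no _ = yesCount-mono F S'⊆S

⊆⇒sameAnswers⊎yesCount< : (F : List (Subset n)) {S' S : Subset n} → S' ⊆ S →
  SameAnswers F S S' ⊎ yesCount F S' < yesCount F S
⊆⇒sameAnswers⊎yesCount< [] S'⊆S = inj₁ []
⊆⇒sameAnswers⊎yesCount< (Q ∷ F) {S'} {S} S'⊆S with nonempty? (Q ∩ S') | nonempty? (Q ∩ S)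
... | yes meets | no ¬meets = contradiction (meets-⊆ Q S'⊆S meets) ¬meets
... | no _ | yes _ = inj₂ (s≤s (yesCount-mono F S'⊆S))
... | yes meets' | yes meets =
  ⊎-map (mk⇔ (λ _ → meets') (λ _ → meets) ∷_) s≤s (⊆⇒sameAnswers⊎yesCount< F S'⊆S)
... | no ¬meets' | no ¬meets =
  ⊎-map₁ (mk⇔ (flip contradiction ¬meets) (flip contradiction ¬meets') ∷_) (⊆⇒sameAnswers⊎yesCount< F S'⊆S)

sameAnswers-refl : (F : List (Subset n)) (S : Subset n) → SameAnswers F S S
sameAnswers-refl [] S = []
sameAnswers-refl (Q ∷ F) S = mk⇔ id id ∷ sameAnswers-refl F S

calG⊆∁Gset : (H : List (Round n)) → All (_⊆ ∁ (Gset H)) (calG H)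
calG⊆∁Gset H = All-map⁺ (universal (λ F {x} → p─q⊆∁q F (Gset H) {x}) (allYes H))

consistent : (H : List (Round n)) {S : Subset n} → S ⊆ ∁ (Gset H) → Hits S (calG H) → ConsistentWith H S
consistent H {S} S⊆∁G hits = disjoint , hits
  where
  disjoint : Empty (S ∩ Gset H)
  disjoint (x , x∈) with x∈p∩q⁻ S (Gset H) x∈
  ... | x∈S , x∈G = x∈∁p⇒x∉p (S⊆∁G x∈S) x∈G

consistent⇒⊆∁Gset : (H : List (Round n)) {S : Subset n} → ConsistentWith H S → S ⊆ ∁ (Gset H)
consistent⇒⊆∁Gset H {S} (disjoint , _) {x} x∈S with x ∈? Gset H
... | yes x∈G = contradiction (x , x∈p∩q⁺ (x∈S , x∈G)) disjoint
... | no x∉G = x∉p⇒x∈∁p x∉G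

module SufficientFamily (d : ℕ) (H : List (Round n)) (F : List (Subset n)) (suff : Suffices d H F) where

  W : Subset n
  W = ∁ (Gset H)

  𝒢 : List (Subset n)
  𝒢 = calG H

  record Pinned (S : Subset n) : Set where
    field
      point : Fin d → Fin n
      point-injective : Injective _≡_ _≡_ point
      point∈S : ∀ k → point k ∈ S
      deletion-drops : ∀ k → ConsistentWith H (S - point k) →
        yesCount F (S - point k) < yesCount F S

  pinned : 1 ≤ d → {S : Subset n} → ConsistentWith H S → d ≤ ∣ S ∣ → Pinned S
  pinned 1≤d {S} consS d≤∣S∣ with suff S consS
  ... | inj₁ allSmall =
    -- d ∸ 1 is truncated subtraction: this is where 1 ≤ d is needed.
    contradiction (≤-trans d≤∣S∣ (allSmall S consS (sameAnswers-refl F S))) (<⇒≱ (∸-monoʳ-< z<s 1≤d))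
  ... | inj₂ (xs , xs-inj , common) = record
    { point = xs
    ; point-injective = xs-inj
    ; point∈S = common S consS (sameAnswers-refl F S)
    ; deletion-drops = drops
    }
    where
    drops : ∀ k → ConsistentWith H (S - xs k) → yesCount F (S - xs k) < yesCount F S
    drops k consS-x with ⊆⇒sameAnswers⊎yesCount< F (p─q⊆p S ⁅ xs k ⁆)
    ... | inj₂ drop = drop
    ... | inj₁ same =
      contradiction (x∈⁅x⁆ (xs k)) (proj₂ (x∈p─q⁻ S ⁅ xs k ⁆ (common (S - xs k) consS-x same k)))

  W-consistent : {A : Subset n} → Hits A 𝒢 → ConsistentWith H W
  W-consistent {A} hitsA = consistent H id (hits-⊆ (p─q⊆∁q A _) (hits-─ (calG⊆∁Gset H) hitsA))

  -- Delete pinned points outside B = A ─ G until fewer than d points are left.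
  small-transversal-bound : 1 ≤ d → (A : Subset n) → Hits A 𝒢 → ∣ A ∣ < d → 1 + ∣ W ∣ ≤ length F + d
  small-transversal-bound 1≤d A hitsA ∣A∣<d = begin
    1 + ∣ W ∣          ≤⟨ descent-bound (yesCount F) Between step (p─q⊆∁q A _ , id) ⟩
    yesCount F W + d   ≤⟨ +-monoˡ-≤ d (yesCount≤length F W) ⟩
    length F + d       ∎
    where
    open ≤-Reasoning
    B = A ─ Gset H
    hitsB : Hits B 𝒢
    hitsB = hits-─ (calG⊆∁Gset H) hitsA
    ∣B∣<d : ∣ B ∣ < d
    ∣B∣<d = ≤-<-trans (p⊆q⇒∣p∣≤∣q∣ (p─q⊆p A (Gset H))) ∣A∣<d

    Between : Subset n → Set
    Between S = B ⊆ S × S ⊆ W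

    step : ∀ {S} → Between S → Deletable (yesCount F) Between S ⊎ 1 + ∣ S ∣ ≤ yesCount F S + d
    step {S} (B⊆S , S⊆W) with ∣ S ∣ <? d
    ... | yes ∣S∣<d = inj₂ (≤-trans ∣S∣<d (m≤n+m d (yesCount F S)))
    ... | no ∣S∣≮d = inj₁ (point k , point∈S k , (B⊆S-x , S-x⊆W) ,
                           deletion-drops k (consistent H S-x⊆W (hits-⊆ B⊆S-x hitsB)))
      where
      open Pinned (pinned 1≤d (consistent H S⊆W (hits-⊆ B⊆S hitsB)) (≮⇒≥ ∣S∣≮d))
      outsideB : ∃ λ k → point k ∉ B
      outsideB = ¬∀⟶∃¬ d _ (λ k → point k ∈? B)
        (λ all∈B → <⇒≱ ∣B∣<d (injection⇒d≤∣p∣ point point-injective B all∈B))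
      k = proj₁ outsideB
      B⊆S-x : B ⊆ S - point k
      B⊆S-x y∈B = x∈p∧x≢y⇒x∈p-y (B⊆S y∈B) λ { refl → proj₂ outsideB y∈B }
      S-x⊆W : S - point k ⊆ W
      S-x⊆W = S⊆W ∘ p─q⊆p S ⁅ point k ⁆

  -- Each pinned point is the only point of S on some member of 𝒢, and these members are distinct.
  stuck-bound : {S : Subset n} → ConsistentWith H S → (pin : Pinned S) →
    (∀ k → ¬ Hits (S - Pinned.point pin k) 𝒢) →
    {m : ℕ} → IsM d 𝒢 m → m + ∣ S ∣ ≤ d + ∣ W ∣
  stuck-bound {S} consS pin stuck ism =
    ≤-trans (+-monoˡ-≤ ∣ S ∣ (proj₂ ism Gs (Gs-injective , Gs∈𝒢)))
            (∣⋃ps∣+∣p∣≤d+∣q∣ Gs point (consistent⇒⊆∁Gset H consS) (lookup (calG⊆∁Gset H) ∘ Gs∈𝒢) trace)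
    where
    open Pinned pin
    witness : ∀ k → ∃ λ Q → Q ∈ₗ 𝒢 × ¬ Meets Q (S - point k)
    witness k = ¬hits⇒unmet 𝒢 (stuck k)
    Gs : Fin d → Subset n
    Gs = proj₁ ∘ witness
    Gs∈𝒢 : ∀ k → Gs k ∈ₗ 𝒢
    Gs∈𝒢 = proj₁ ∘ proj₂ ∘ witness
    trace : ∀ k {y} → y ∈ Gs k → y ∈ S → y ≡ point k
    trace k = ¬meets-p-x⇒≡ (proj₂ (proj₂ (witness k)))
    point∈Gs : ∀ k → point k ∈ Gs k
    point∈Gs k with lookup (proj₂ consS) (Gs∈𝒢 k)
    ... | y , y∈ with x∈p∩q⁻ (Gs k) S y∈
    ...   | y∈Gs , y∈S = subst (_∈ Gs k) (trace k y∈Gs y∈S) y∈Gs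
    Gs-injective : Injective _≡_ _≡_ Gs
    Gs-injective {i} {j} Gsᵢ≡Gsⱼ =
      point-injective (trace j (subst (point i ∈_) Gsᵢ≡Gsⱼ (point∈Gs i)) (point∈S i))

  -- Delete pinned points while the set stays consistent; then apply stuck-bound.
  large-transversal-bound : 1 ≤ d → (A : Subset n) → SmallestHitting A 𝒢 → d ≤ ∣ A ∣ →
    {m : ℕ} → IsM d 𝒢 m → m ≤ length F + d
  large-transversal-bound 1≤d A (hitsA , minimal) d≤∣A∣ {m} ism = begin
    m                  ≤⟨ +-cancelʳ-≤ ∣ W ∣ m _ (≤-trans descent (≤-reflexive (sym (+-assoc _ d ∣ W ∣)))) ⟩
    yesCount F W + d   ≤⟨ +-monoˡ-≤ d (yesCount≤length F W) ⟩
    length F + d       ∎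
    where
    open ≤-Reasoning
    Bound : Subset n → Set
    Bound S = m + ∣ S ∣ ≤ yesCount F S + (d + ∣ W ∣)

    step : ∀ {S} → ConsistentWith H S → Deletable (yesCount F) (ConsistentWith H) S ⊎ Bound S
    step {S} consS = deleteOrStuck (pinned 1≤d consS (≤-trans d≤∣A∣ (minimal S (proj₂ consS))))
      where
      deleteOrStuck : Pinned S → Deletable (yesCount F) (ConsistentWith H) S ⊎ Bound S
      deleteOrStuck pin with any? (λ k → hits? (S - Pinned.point pin k) 𝒢)
      ... | yes (k , hits) = inj₁ (point k , point∈S k , consS-x , deletion-drops k consS-x)
        where
        open Pinned pin
        consS-x : ConsistentWith H (S - point k)
        consS-x = consistent H (consistent⇒⊆∁Gset H consS ∘ p─q⊆p S ⁅ point k ⁆) hits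
      ... | no none = inj₂ (≤-trans (stuck-bound consS pin (λ k hits → none (k , hits)) ism)
                                    (m≤n+m (d + ∣ W ∣) (yesCount F S)))

    descent : Bound W
    descent = descent-bound (yesCount F) (ConsistentWith H) step (W-consistent hitsA)

lemma2p5 : (n d r : ℕ) → 2 ≤ r → 1 ≤ d → d ≤ n →
    (H : List (Round n)) → length H ≡ r ∸ 1 →
    Convention H → AnswersConsistent H →
    (A : Subset n) → SmallestHitting A (calG H) →
    (F : List (Subset n)) → Unique F → All (λ Q → Q ⊆ ∁ (Gset H)) F →
    Suffices d H F →
    ((d ≤ ∣ A ∣ → (m : ℕ) → IsM d (calG H) m → m ∸ d ≤ length F)
     × (∣ A ∣ < d → n + 1 ≤ length F + ∣ Gset H ∣ + d))
lemma2p5 n d r _ 1≤d _ H _ _ _ A A-smallest F _ _ suff = large , small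
  where
  open SufficientFamily d H F suff
  G = Gset H

  large : d ≤ ∣ A ∣ → (m : ℕ) → IsM d 𝒢 m → m ∸ d ≤ length F
  large d≤∣A∣ m ism = m≤n+o⇒m∸n≤o m d (subst (m ≤_) (+-comm (length F) d)
    (large-transversal-bound 1≤d A A-smallest d≤∣A∣ ism))

  small : ∣ A ∣ < d → n + 1 ≤ length F + ∣ G ∣ + d
  small ∣A∣<d = begin
    n + 1                  ≡⟨ cong (_+ 1) (sym (∣∁p∣+∣p∣≡n G)) ⟩
    ∣ W ∣ + ∣ G ∣ + 1      ≡⟨ solve 2 (λ w g → w :+ g :+ con 1 := g :+ (con 1 :+ w)) refl ∣ W ∣ ∣ G ∣ ⟩
    ∣ G ∣ + (1 + ∣ W ∣)    ≤⟨ +-monoʳ-≤ ∣ G ∣ (small-transversal-bound 1≤d A (proj₁ A-smallest) ∣A∣<d) ⟩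
    ∣ G ∣ + (length F + d) ≡⟨ solve 3 (λ g f d → g :+ (f :+ d) := f :+ g :+ d) refl ∣ G ∣ (length F) d ⟩
    length F + ∣ G ∣ + d   ∎
    where
    open ≤-Reasoning
    open +-*-Solver
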